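{- Let $P$ be a finite poset with $|P|\ge 2$ whose Hasse diagram is connected, and let $r$ be a positive integer. Then $P$ has an $r$-Gorenstein labeling if and only if each biconnected component of $P$ has an $r$-Gorenstein labeling.
   Context: A biconnected component of $P$ is a maximal biconnected subgraph (block) of the undirected Hasse diagram of $P$, regarded as the subposet of $P$ induced on its vertex set. For a poset $Q$ and $S\subseteq Q$, $cc(S)$ is the number of connected components of the subgraph of the undirected Hasse diagram of $Q$ induced on $S$ ($cc(\varnothing)=0$); for an upset $A$ of $Q$, $\dim(A)=cc(A)+cc(Q\setminus A)-1$. An $r$-Gorenstein labeling of $Q$ is $\phi:Q\to\mathbb{Z}$ with $\sum_{z\in Q}\phi(z)=0$ and $\sum_{z\in A}\phi(z)=r$ for every upset $A$ of $Q$ with $\dim(A)=1$. -}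

module Defs where

open import Data.Nat using (ℕ)
open import Data.Fin using (Fin)
open import Data.Bool using (Bool; true; false; if_then_else_; _∧_; not)
open import Data.Integer using (ℤ; +_; _+_; _-_; 0ℤ)
open import Data.List using (List; map; foldr)
open import Data.Fin.Base using ()
open import Data.List using (allFin)
open import Data.Product using (Σ; ∃; _×_; Σ-syntax; ∃-syntax)
open import Data.Sum using (_⊎_)
open import Function.Bundles using (_⇔_)
open import Relation.Binary.PropositionalEquality using (_≡_; _≢_)
open import Relation.Binary.Structures using (IsPartialOrder)
open import Relation.Binary.Definitions using (Decidable)
open import Relation.Nullary using (does)
import Data.Fin

record FinPoset (n : ℕ) : Set₁ where
  field
    _≤_ : Fin n → Fin n → Set
    isPartialOrder : IsPartialOrder _≡_ _≤_
    _≤?_ : Decidable _≤_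

Subset : ℕ → Set
Subset n = Fin n → Bool

_∈_ : ∀ {n} → Fin n → Subset n → Set
x ∈ S = S x ≡ true

_⊆_ : ∀ {n} → Subset n → Subset n → Set
S ⊆ T = ∀ x → x ∈ S → x ∈ T

full : ∀ {n} → Subset n
full _ = true

_∖_ : ∀ {n} → Subset n → Subset n → Subset n
(G ∖ S) x = G x ∧ not (S x)

_─_ : ∀ {n} → Subset n → Fin n → Subset n
(S ─ v) x = if does (x Data.Fin.≟ v) then false else S x

module _ {n : ℕ} (P : FinPoset n) where
  open FinPoset P

  -- The subposet Q of P induced on the vertex set G.
  -- Cover relation of Q:  x ⋖ y  in Q.
  CoversIn : Subset n → Fin n → Fin n → Set
  CoversIn G x y =
    x ∈ G × y ∈ G × x ≤ y × x ≢ y ×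
    (∀ z → z ∈ G → x ≤ z → z ≤ y → (z ≡ x) ⊎ (z ≡ y))

  HasseAdj : Subset n → Fin n → Fin n → Set
  HasseAdj G x y = CoversIn G x y ⊎ CoversIn G y x

  -- Paths in the subgraph of the Hasse diagram of Q induced on S.
  data Reach (G S : Subset n) : Fin n → Fin n → Set where
    here : ∀ {x} → x ∈ S → Reach G S x x
    step : ∀ {x y z} → x ∈ S → HasseAdj G x y → Reach G S y z → Reach G S x z

  -- cc(S) = k in Q (Q the subposet on G): the vertices of S are labelled
  -- surjectively by Fin k so that two vertices get the same label iff they
  -- are joined by a path inside S.
  CC : (G S : Subset n) → ℕ → Set
  CC G S k =
    Σ[ f ∈ ((x : Fin n) → x ∈ S → Fin k) ]
      ((∀ j → ∃[ x ] Σ[ p ∈ x ∈ S ] f x p ≡ j) ×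
       (∀ x y (p : x ∈ S) (q : y ∈ S) → (f x p ≡ f y q) ⇔ Reach G S x y))

  IsUpset : (G A : Subset n) → Set
  IsUpset G A = A ⊆ G × (∀ x y → x ∈ G → y ∈ G → x ∈ A → x ≤ y → y ∈ A)

  DimOne : (G A : Subset n) → Set
  DimOne G A = ∃[ k ] ∃[ l ] (CC G A k × CC G (G ∖ A) l × ((+ k + + l) - + 1 ≡ + 1))

  sumOver : Subset n → (Fin n → ℤ) → ℤ
  sumOver S φ = foldr _+_ 0ℤ (map (λ x → if S x then φ x else 0ℤ) (allFin n))

  -- r-Gorenstein labeling of the subposet Q on G (values outside G irrelevant)
  IsGorensteinLabeling : (G : Subset n) → ℤ → (Fin n → ℤ) → Set
  IsGorensteinLabeling G r φ =
    sumOver G φ ≡ 0ℤ × (∀ A → IsUpset G A → DimOne G A → sumOver A φ ≡ r)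

  HasGorensteinLabeling : Subset n → ℤ → Set
  HasGorensteinLabeling G r = ∃[ φ ] IsGorensteinLabeling G r φ

  HasseConnected : Set
  HasseConnected = ∀ x y → Reach full full x y

  Biconnected : Subset n → Set
  Biconnected B =
    (∃[ x ] ∃[ y ] (x ∈ B × y ∈ B × x ≢ y)) ×
    (∀ x y → x ∈ B → y ∈ B → Reach full B x y) ×
    (∀ v → v ∈ B → ∀ x y → x ∈ (B ─ v) → y ∈ (B ─ v) → Reach full (B ─ v) x y)

  IsBlock : Subset n → Set
  IsBlock B = Biconnected B × (∀ B' → Biconnected B' → B ⊆ B' → B' ⊆ B)

module Submission where

-- Forward: every x of P reaches the block B by a path meeting B only at its end, and this
-- end π x is unique, since two of them would be joined through x ∉ B by a path that the
-- block would have to absorb. Preimages under π of dimension-one upsets of B are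
-- dimension-one upsets of P, so pushing a labeling of P forward along π labels B.
-- Backward: add up the labelings of all blocks, each extended by zero. A dimension-one
-- upset A of P is straddled by exactly one block (the block of an edge leaving A), which it
-- meets in a dimension-one upset; every other block lies inside A or misses it, and so
-- contributes 0.

open import Defs
open import Data.Nat using (ℕ; zero; suc; _≤_; _<_; z≤n; s≤s) renaming (_+_ to _+ℕ_)
open import Data.Nat.Properties
  using (≤-trans; <-≤-trans; <-irrefl; ≤-reflexive; ≤-pred; m≤n⇒m≤1+n; n≮0; +-identityʳ; +-suc; +-monoˡ-≤; m≤n+m)
open import Data.Fin using (Fin; zero; suc; punchIn) renaming (_≟_ to _≟ᶠ_)
open import Data.Fin.Properties using (¬Fin0; 0≢1+n; punchInᵢ≢i; any?; all?)
open import Data.Bool using (Bool; true; false; if_then_else_; _∧_; _∨_)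
import Data.Bool.Properties as Boolₚ
open import Data.Integer using (ℤ; +_; _+_; _-_; 0ℤ)
import Data.Integer.Properties as ℤₚ
open import Algebra.Properties.CommutativeMonoid.Sum ℤₚ.+-0-commutativeMonoid
  using (sum; sum-cong-≗; ∑-comm; ∑-distrib-+; sum-replicate-zero; sum-remove)
open import Data.List using (List; []; _∷_; _++_; map; foldr; tabulate)
open import Data.List.Membership.Propositional using () renaming (_∈_ to _∈ₗ_; _∉_ to _∉ₗ_)
open import Data.List.Membership.Propositional.Properties using (∈-++⁺ˡ; ∈-++⁺ʳ; ∈-++⁻)
open import Data.List.Relation.Unary.Any using (here; there)
open import Data.Product using (Σ; ∃; ∃₂; _×_; _,_; proj₁; proj₂)
open import Data.Sum using (_⊎_; inj₁; inj₂; [_,_]′)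
open import Data.Empty using (⊥; ⊥-elim)
open import Data.Unit using (⊤; tt)
open import Function using (_∘_; id)
open import Function.Bundles using (_⇔_; mk⇔; Equivalence)
open import Relation.Nullary using (¬_; Dec; yes; no; does)
open import Relation.Nullary.Decidable using (_×-dec_; _⊎-dec_; _→-dec_; ¬?; dec-true; dec-false)
open import Relation.Binary.PropositionalEquality
  using (_≡_; _≢_; refl; sym; trans; cong; cong₂; subst; module ≡-Reasoning)
open import Relation.Binary.Structures using (IsPartialOrder)

private variable
  m : ℕ

false≢true : false ≢ true
false≢true ()

_∉_ : Fin m → Subset m → Set
x ∉ S = ¬ x ∈ S

_∈?_ : (x : Fin m) (S : Subset m) → Dec (x ∈ S)
x ∈? S = S x Boolₚ.≟ true

≢true⇒≡false : ∀ {b} → ¬ b ≡ true → b ≡ false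
≢true⇒≡false {true} b≢true = ⊥-elim (b≢true refl)
≢true⇒≡false {false} _ = refl

from-does : ∀ {p} {A : Set p} (a? : Dec A) → does a? ≡ true → A
from-does (yes a) _ = a

_∩_ : Subset m → Subset m → Subset m
(S ∩ T) x = S x ∧ T x

_∪_ : Subset m → Subset m → Subset m
(S ∪ T) x = S x ∨ T x

_≐_ : Subset m → Subset m → Set
S ≐ T = ∀ x → S x ≡ T x

≐-sym : {S T : Subset m} → S ≐ T → T ≐ S
≐-sym S≐T x = sym (S≐T x)

≐⇒⊆ : {S T : Subset m} → S ≐ T → S ⊆ T
≐⇒⊆ S≐T x x∈S = trans (sym (S≐T x)) x∈S

⊆-antisym : {S T : Subset m} → S ⊆ T → T ⊆ S → S ≐ T
⊆-antisym {S = S} {T} S⊆T T⊆S x with S x in Sx | T x in Tx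
... | true  | true  = refl
... | false | false = refl
... | true  | false = ⊥-elim (false≢true (trans (sym Tx) (S⊆T x Sx)))
... | false | true  = ⊥-elim (false≢true (trans (sym Sx) (T⊆S x Tx)))

∈-∩⁻ : ∀ (S T : Subset m) {x} → x ∈ (S ∩ T) → x ∈ S × x ∈ T
∈-∩⁻ S T {x} x∈ with S x | T x
... | true | true = refl , refl

∈-∩⁺ : ∀ (S T : Subset m) {x} → x ∈ S → x ∈ T → x ∈ (S ∩ T)
∈-∩⁺ S T {x} x∈S x∈T rewrite x∈S | x∈T = refl

∈-∪ˡ : ∀ (S T : Subset m) {x} → x ∈ S → x ∈ (S ∪ T)
∈-∪ˡ S T {x} x∈S rewrite x∈S = refl

∈-∪ʳ : ∀ (S T : Subset m) {x} → x ∈ T → x ∈ (S ∪ T)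
∈-∪ʳ S T {x} x∈T rewrite x∈T = Boolₚ.∨-zeroʳ (S x)

∈-∪⁻ : ∀ (S T : Subset m) {x} → x ∈ (S ∪ T) → x ∈ S ⊎ x ∈ T
∈-∪⁻ S T {x} x∈ with S x
... | true  = inj₁ refl
... | false = inj₂ x∈

∈-∖⁻ : ∀ (G A : Subset m) {x} → x ∈ (G ∖ A) → x ∈ G × A x ≡ false
∈-∖⁻ G A {x} x∈ with G x | A x
... | true | false = refl , refl

∈-∖⁺ : ∀ (G A : Subset m) {x} → x ∈ G → A x ≡ false → x ∈ (G ∖ A)
∈-∖⁺ G A {x} x∈G x∉A rewrite x∈G | x∉A = refl

∈-─⁻ : ∀ (S : Subset m) v {x} → x ∈ (S ─ v) → x ∈ S × x ≢ v
∈-─⁻ S v {x} x∈ with x ≟ᶠ v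
... | no x≢v = x∈ , x≢v

∈-─⁺ : ∀ (S : Subset m) v {x} → x ∈ S → x ≢ v → x ∈ (S ─ v)
∈-─⁺ S v {x} x∈S x≢v with x ≟ᶠ v
... | yes x≡v = ⊥-elim (x≢v x≡v)
... | no _ = x∈S

∖-∩ : (S A : Subset m) → (S ∖ (S ∩ A)) ≐ (S ∩ (full ∖ A))
∖-∩ S A x with S x
... | true  = refl
... | false = refl

─-mono : ∀ {S T : Subset m} v → S ⊆ T → (S ─ v) ⊆ (T ─ v)
─-mono {S = S} {T} v S⊆T x x∈ =
  let x∈S , x≢v = ∈-─⁻ S v x∈ in ∈-─⁺ T v (S⊆T x x∈S) x≢v

size : Subset m → ℕ
size {zero} S = 0
size {suc m} S = (if S zero then 1 else 0) +ℕ size (λ i → S (suc i))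

size-mono : (S T : Subset m) → S ⊆ T → size S ≤ size T
size-mono {zero} S T S⊆T = z≤n
size-mono {suc m} S T S⊆T with S zero in S0 | T zero in T0
... | true  | true  = s≤s (size-mono _ _ (λ t → S⊆T (suc t)))
... | true  | false = ⊥-elim (false≢true (trans (sym T0) (S⊆T zero S0)))
... | false | true  = m≤n⇒m≤1+n (size-mono _ _ (λ t → S⊆T (suc t)))
... | false | false = size-mono _ _ (λ t → S⊆T (suc t))

size-strict : (S T : Subset m) → S ⊆ T → ∀ x → x ∈ T → x ∉ S → size S < size T
size-strict {suc m} S T S⊆T zero x∈T x∉S with S zero | T zero
... | true  | _     = ⊥-elim (x∉S refl)
... | false | true  = s≤s (size-mono _ _ (λ t → S⊆T (suc t)))
... | false | false = ⊥-elim (false≢true x∈T)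
size-strict {suc m} S T S⊆T (suc x) x∈T x∉S with S zero in S0 | T zero in T0
... | true  | true  = s≤s (size-strict _ _ (λ t → S⊆T (suc t)) x x∈T x∉S)
... | true  | false = ⊥-elim (false≢true (trans (sym T0) (S⊆T zero S0)))
... | false | true  = m≤n⇒m≤1+n (size-strict _ _ (λ t → S⊆T (suc t)) x x∈T x∉S)
... | false | false = size-strict _ _ (λ t → S⊆T (suc t)) x x∈T x∉S

size≤ : (S : Subset m) → size S ≤ m
size≤ {zero} S = z≤n
size≤ {suc m} S with S zero
... | true  = s≤s (size≤ _)
... | false = m≤n⇒m≤1+n (size≤ _)

nonempty⇒size>0 : (S : Subset m) → ∀ x → x ∈ S → 0 < size S
nonempty⇒size>0 S x x∈S = ≤-trans (s≤s z≤n) (size-strict (λ _ → false) S (λ _ ()) x x∈S (λ ()))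

sum-zero : {f : Fin m → ℤ} → (∀ i → f i ≡ 0ℤ) → sum f ≡ 0ℤ
sum-zero {m} f≡0 = trans (sum-cong-≗ f≡0) (sum-replicate-zero m)

sum-single : (f : Fin m → ℤ) (j : Fin m) → (∀ i → i ≢ j → f i ≡ 0ℤ) → sum f ≡ f j
sum-single {suc m} f j f≡0 = begin
  sum f                       ≡⟨ sum-remove {i = j} f ⟩
  f j + sum (f ∘ punchIn j)   ≡⟨ cong (λ s → f j + s) (sum-zero (λ k → f≡0 _ (punchInᵢ≢i j k))) ⟩
  f j + 0ℤ                    ≡⟨ ℤₚ.+-identityʳ (f j) ⟩
  f j                         ∎
  where open ≡-Reasoning

extendByZero : Subset m → (Fin m → ℤ) → Fin m → ℤ
extendByZero S φ x = if S x then φ x else 0ℤ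

foldr-map-tabulate : ∀ {a} {A : Set a} (g : A → ℤ) (h : Fin m → A) →
                     foldr _+_ 0ℤ (map g (tabulate h)) ≡ sum (g ∘ h)
foldr-map-tabulate {zero} g h = refl
foldr-map-tabulate {suc m} g h = cong (λ s → g (h zero) + s) (foldr-map-tabulate g (h ∘ suc))

pushforward : ∀ {m k} → (Fin m → Fin k) → (Fin m → ℤ) → Fin k → ℤ
pushforward f φ b = sum (λ x → if does (f x ≟ᶠ b) then φ x else 0ℤ)

_◂_ : Bool → Subset m → Subset (suc m)
(b ◂ S) zero = b
(b ◂ S) (suc i) = S i

◂-cong : ∀ {S T : Subset m} b → S ≐ T → (b ◂ S) ≐ (b ◂ T)
◂-cong b S≐T zero = refl
◂-cong b S≐T (suc i) = S≐T i

◂-tail : (S : Subset (suc m)) → S ≐ (S zero ◂ (S ∘ suc))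
◂-tail S zero = refl
◂-tail S (suc i) = refl

sumSubsets : ∀ m → (Subset m → ℤ) → ℤ
sumSubsets zero f = f (λ ())
sumSubsets (suc m) f = sumSubsets m (f ∘ (true ◂_)) + sumSubsets m (f ∘ (false ◂_))

sumSubsets-zero : ∀ m {f : Subset m → ℤ} → (∀ S → f S ≡ 0ℤ) → sumSubsets m f ≡ 0ℤ
sumSubsets-zero zero f≡0 = f≡0 _
sumSubsets-zero (suc m) f≡0 = cong₂ _+_ (sumSubsets-zero m (f≡0 ∘ _)) (sumSubsets-zero m (f≡0 ∘ _))

sumSubsets-cong : ∀ m {f g : Subset m → ℤ} → (∀ S → f S ≡ g S) → sumSubsets m f ≡ sumSubsets m g
sumSubsets-cong zero f≡g = f≡g _
sumSubsets-cong (suc m) f≡g = cong₂ _+_ (sumSubsets-cong m (f≡g ∘ _)) (sumSubsets-cong m (f≡g ∘ _))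

∑-sumSubsets-comm : ∀ {k} m (f : Subset m → Fin k → ℤ) →
                    sum (λ x → sumSubsets m (λ S → f S x)) ≡ sumSubsets m (λ S → sum (f S))
∑-sumSubsets-comm zero f = refl
∑-sumSubsets-comm (suc m) f = trans
  (∑-distrib-+ (λ x → sumSubsets m (λ S → f (true ◂ S) x)) (λ x → sumSubsets m (λ S → f (false ◂ S) x)))
  (cong₂ _+_ (∑-sumSubsets-comm m (f ∘ (true ◂_))) (∑-sumSubsets-comm m (f ∘ (false ◂_))))

sumSubsets-single : ∀ m (f : Subset m → ℤ) (S₀ : Subset m) {v} →
                    (∀ S → S ≐ S₀ → f S ≡ v) → (∀ S → ¬ S ≐ S₀ → f S ≡ 0ℤ) → sumSubsets m f ≡ v
sumSubsets-single zero f S₀ at-S₀ elsewhere = at-S₀ _ (λ ())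
sumSubsets-single (suc m) f S₀ {v} at-S₀ elsewhere = by-head (S₀ zero) refl
  where
  matching : ∀ {b} → S₀ zero ≡ b → sumSubsets m (f ∘ (b ◂_)) ≡ v
  matching head = sumSubsets-single m _ (S₀ ∘ suc)
    (λ S S≐ → at-S₀ _ λ { zero → sym head ; (suc i) → S≐ i }) (λ S S≢ → elsewhere _ (λ S≐ → S≢ (S≐ ∘ suc)))
  mismatching : ∀ {b} → S₀ zero ≢ b → sumSubsets m (f ∘ (b ◂_)) ≡ 0ℤ
  mismatching head≢ = sumSubsets-zero m (λ S → elsewhere _ (λ S≐ → head≢ (sym (S≐ zero))))
  by-head : ∀ b → S₀ zero ≡ b → sumSubsets (suc m) f ≡ v
  by-head true head = trans (cong₂ _+_ (matching head) (mismatching λ e → false≢true (trans (sym e) head)))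
                            (ℤₚ.+-identityʳ v)
  by-head false head = trans (cong₂ _+_ (mismatching λ e → false≢true (trans (sym head) e)) (matching head))
                             (ℤₚ.+-identityˡ v)

any-subset? : ∀ m (Q : Subset m → Set) → (∀ S → Dec (Q S)) → (∀ {S T} → S ≐ T → Q S → Q T) → Dec (∃ Q)
any-subset? zero Q Q? resp with Q? (λ ())
... | yes q = yes (_ , q)
... | no ¬q = no λ (S , q) → ¬q (resp (λ ()) q)
any-subset? (suc m) Q Q? resp
  with any-subset? m (Q ∘ (true ◂_)) (Q? ∘ (true ◂_)) (resp ∘ ◂-cong true)
     | any-subset? m (Q ∘ (false ◂_)) (Q? ∘ (false ◂_)) (resp ∘ ◂-cong false)
... | yes (S , q) | _ = yes (_ , q)
... | no _ | yes (S , q) = yes (_ , q)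
... | no ¬qt | no ¬qf = no λ (S , q) → by-head S (S zero) (resp (◂-tail S) q)
  where
  by-head : ∀ S b → Q (b ◂ (S ∘ suc)) → ⊥
  by-head S true q = ¬qt (_ , q)
  by-head S false q = ¬qf (_ , q)

module _ {n : ℕ} (P : FinPoset n) where

  sumOver≡sum : ∀ S φ → sumOver P S φ ≡ sum (extendByZero S φ)
  sumOver≡sum S φ = foldr-map-tabulate (extendByZero S φ) id

  sumOver-cong : ∀ {S T} φ → S ≐ T → sumOver P S φ ≡ sumOver P T φ
  sumOver-cong {S} {T} φ S≐T = begin
    sumOver P S φ              ≡⟨ sumOver≡sum S φ ⟩
    sum (extendByZero S φ)     ≡⟨ sum-cong-≗ (λ x → cong (if_then φ x else 0ℤ) (S≐T x)) ⟩
    sum (extendByZero T φ)     ≡⟨ sumOver≡sum T φ ⟨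
    sumOver P T φ              ∎
    where open ≡-Reasoning

  sumOver-empty : ∀ {S} φ → (∀ x → S x ≡ false) → sumOver P S φ ≡ 0ℤ
  sumOver-empty {S} φ S≡∅ =
    trans (sumOver≡sum S φ) (sum-zero (λ x → cong (if_then φ x else 0ℤ) (S≡∅ x)))

  sumOver-zero : ∀ X → sumOver P X (λ _ → 0ℤ) ≡ 0ℤ
  sumOver-zero X = trans (sumOver≡sum X _) (sum-zero zero-either-way)
    where
    zero-either-way : ∀ x → extendByZero X (λ _ → 0ℤ) x ≡ 0ℤ
    zero-either-way x with X x
    ... | true  = refl
    ... | false = refl

  sumOver-extendByZero : ∀ X S φ → sumOver P X (extendByZero S φ) ≡ sumOver P (S ∩ X) φ
  sumOver-extendByZero X S φ = begin
    sumOver P X (extendByZero S φ)          ≡⟨ sumOver≡sum X _ ⟩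
    sum (extendByZero X (extendByZero S φ)) ≡⟨ sum-cong-≗ masks ⟩
    sum (extendByZero (S ∩ X) φ)            ≡⟨ sumOver≡sum (S ∩ X) φ ⟨
    sumOver P (S ∩ X) φ                     ∎
    where
    open ≡-Reasoning
    masks : ∀ x → extendByZero X (extendByZero S φ) x ≡ extendByZero (S ∩ X) φ x
    masks x with S x | X x
    ... | true  | true  = refl
    ... | true  | false = refl
    ... | false | true  = refl
    ... | false | false = refl

  sumOver-sumSubsets : ∀ X (g : Subset n → Fin n → ℤ) →
    sumOver P X (λ x → sumSubsets n (λ S → g S x)) ≡ sumSubsets n (λ S → sumOver P X (g S))
  sumOver-sumSubsets X g = begin
    sumOver P X (λ x → sumSubsets n (λ S → g S x))               ≡⟨ sumOver≡sum X _ ⟩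
    sum (extendByZero X (λ x → sumSubsets n (λ S → g S x)))       ≡⟨ sum-cong-≗ mask-inside ⟩
    sum (λ x → sumSubsets n (λ S → extendByZero X (g S) x))       ≡⟨ ∑-sumSubsets-comm n (extendByZero X ∘ g) ⟩
    sumSubsets n (λ S → sum (extendByZero X (g S)))               ≡⟨ sumSubsets-cong n (λ S → sumOver≡sum X (g S)) ⟨
    sumSubsets n (λ S → sumOver P X (g S))                        ∎
    where
    open ≡-Reasoning
    mask-inside : ∀ x → extendByZero X (λ x → sumSubsets n (λ S → g S x)) x
                      ≡ sumSubsets n (λ S → extendByZero X (g S) x)
    mask-inside x with X x
    ... | true  = refl
    ... | false = sym (sumSubsets-zero n (λ _ → refl))

  sumOver-pushforward : ∀ A (f : Fin n → Fin n) φ → sumOver P A (pushforward f φ) ≡ sumOver P (A ∘ f) φ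
  sumOver-pushforward A f φ = begin
    sumOver P A (pushforward f φ)                ≡⟨ sumOver≡sum A _ ⟩
    sum (extendByZero A (pushforward f φ))       ≡⟨ sum-cong-≗ mask-inside ⟩
    sum (λ b → sum (λ x → term b x))             ≡⟨ ∑-comm term ⟩
    sum (λ x → sum (λ b → term b x))             ≡⟨ sum-cong-≗ (λ x → sum-single _ (f x) (off-fibre x)) ⟩
    sum (λ x → term (f x) x)                     ≡⟨ sum-cong-≗ on-fibre ⟩
    sum (extendByZero (A ∘ f) φ)                 ≡⟨ sumOver≡sum (A ∘ f) φ ⟨
    sumOver P (A ∘ f) φ                          ∎
    where
    open ≡-Reasoning
    term : Fin n → Fin n → ℤ
    term b x = if A b ∧ does (f x ≟ᶠ b) then φ x else 0ℤ
    mask-inside : ∀ b → extendByZero A (pushforward f φ) b ≡ sum (term b)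
    mask-inside b with A b
    ... | true  = refl
    ... | false = sym (sum-zero {n} (λ _ → refl))
    off-fibre : ∀ x b → b ≢ f x → term b x ≡ 0ℤ
    off-fibre x b b≢fx rewrite dec-false (f x ≟ᶠ b) (b≢fx ∘ sym) | Boolₚ.∧-zeroʳ (A b) = refl
    on-fibre : ∀ x → term (f x) x ≡ extendByZero (A ∘ f) φ x
    on-fibre x rewrite dec-true (f x ≟ᶠ f x) refl | Boolₚ.∧-identityʳ (A (f x)) = refl

s-1≡1⇒s≡2 : ∀ s → + s - + 1 ≡ + 1 → s ≡ 2
s-1≡1⇒s≡2 (suc (suc zero)) _ = refl
s-1≡1⇒s≡2 (suc (suc (suc s))) eq with ℤₚ.+-injective eq
... | ()

module _ {n : ℕ} (P : FinPoset n) where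

  open FinPoset P using () renaming (_≤_ to _⊑_; _≤?_ to _⊑?_)
  module ⊑ = IsPartialOrder (FinPoset.isPartialOrder P)
  open import Data.List.Membership.DecPropositional (_≟ᶠ_ {n}) using () renaming (_∈?_ to _∈ₗ?_)

  Adj : Fin n → Fin n → Set
  Adj = HasseAdj P full

  HasseAdj-sym : ∀ {G x y} → HasseAdj P G x y → HasseAdj P G y x
  HasseAdj-sym (inj₁ x⋖y) = inj₂ x⋖y
  HasseAdj-sym (inj₂ y⋖x) = inj₁ y⋖x

  data Walk : Fin n → Fin n → Set where
    [_] : ∀ x → Walk x x
    _◅_ : ∀ {x y z} → Adj x y → Walk y z → Walk x z

  infixr 5 _◅_

  vertices : ∀ {x y} → Walk x y → List (Fin n)
  vertices [ x ] = x ∷ []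
  vertices (_◅_ {x} _ w) = x ∷ vertices w

  Inside : ∀ {x y} → Subset n → Walk x y → Set
  Inside S w = ∀ t → t ∈ₗ vertices w → t ∈ S

  Simple : ∀ {x y} → Walk x y → Set
  Simple [ x ] = ⊤
  Simple (_◅_ {x} _ w) = x ∉ₗ vertices w × Simple w

  first∈ : ∀ {x y} (w : Walk x y) → x ∈ₗ vertices w
  first∈ [ x ] = here refl
  first∈ (_ ◅ w) = here refl

  last∈ : ∀ {x y} (w : Walk x y) → y ∈ₗ vertices w
  last∈ [ x ] = here refl
  last∈ (_ ◅ w) = there (last∈ w)

  _++⟨_⟩_ : ∀ {x y y′ z} → Walk x y → Adj y y′ → Walk y′ z → Walk x z
  [ x ] ++⟨ e ⟩ w = e ◅ w
  (a ◅ v) ++⟨ e ⟩ w = a ◅ (v ++⟨ e ⟩ w)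

  vertices-++⟨⟩ : ∀ {x y y′ z} (v : Walk x y) (e : Adj y y′) (w : Walk y′ z) →
                  vertices (v ++⟨ e ⟩ w) ≡ vertices v ++ vertices w
  vertices-++⟨⟩ [ x ] e w = refl
  vertices-++⟨⟩ (a ◅ v) e w = cong (_ ∷_) (vertices-++⟨⟩ v e w)

  module _ {x y y′ z} (v : Walk x y) (e : Adj y y′) (w : Walk y′ z) {t : Fin n} where

    ∈-++⟨⟩⁻ : t ∈ₗ vertices (v ++⟨ e ⟩ w) → t ∈ₗ vertices v ⊎ t ∈ₗ vertices w
    ∈-++⟨⟩⁻ t∈ = ∈-++⁻ (vertices v) (subst (t ∈ₗ_) (vertices-++⟨⟩ v e w) t∈)

    ∈-++⟨⟩⁺ˡ : t ∈ₗ vertices v → t ∈ₗ vertices (v ++⟨ e ⟩ w)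
    ∈-++⟨⟩⁺ˡ t∈ = subst (t ∈ₗ_) (sym (vertices-++⟨⟩ v e w)) (∈-++⁺ˡ t∈)

    ∈-++⟨⟩⁺ʳ : t ∈ₗ vertices w → t ∈ₗ vertices (v ++⟨ e ⟩ w)
    ∈-++⟨⟩⁺ʳ t∈ = subst (t ∈ₗ_) (sym (vertices-++⟨⟩ v e w)) (∈-++⁺ʳ (vertices v) t∈)

  ++⟨⟩-simple : ∀ {x y y′ z} (v : Walk x y) (e : Adj y y′) (w : Walk y′ z) → Simple v → Simple w →
                (∀ t → t ∈ₗ vertices v → t ∈ₗ vertices w → ⊥) → Simple (v ++⟨ e ⟩ w)
  ++⟨⟩-simple [ x ] e w _ w-simple disjoint = (λ x∈w → disjoint x (here refl) x∈w) , w-simple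
  ++⟨⟩-simple (a ◅ v) e w (x∉v , v-simple) w-simple disjoint =
    (λ x∈ → [ x∉v , disjoint _ (here refl) ]′ (∈-++⟨⟩⁻ v e w x∈)) ,
    ++⟨⟩-simple v e w v-simple w-simple (λ t t∈v → disjoint t (there t∈v))

  record Split {x z} (w : Walk x z) (v : Fin n) : Set where
    field
      pre  : Walk x v
      post : Walk v z
      pre⊆  : ∀ t → t ∈ₗ vertices pre → t ∈ₗ vertices w
      post⊆ : ∀ t → t ∈ₗ vertices post → t ∈ₗ vertices w
      simple : Simple w → Simple pre × Simple post ×
               (∀ t → t ∈ₗ vertices pre → t ∈ₗ vertices post → t ≡ v)

  split : ∀ {x z v} (w : Walk x z) → v ∈ₗ vertices w → Split w v
  split [ x ] (here refl) = record
    { pre = [ x ] ; post = [ x ] ; pre⊆ = λ _ t∈ → t∈ ; post⊆ = λ _ t∈ → t∈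
    ; simple = λ _ → tt , tt , λ { t (here t≡x) _ → t≡x } }
  split (_◅_ {x} a w) (here refl) = record
    { pre = [ x ] ; post = a ◅ w ; pre⊆ = λ { t (here refl) → here refl } ; post⊆ = λ _ t∈ → t∈
    ; simple = λ w-simple → tt , w-simple , λ { t (here t≡x) _ → t≡x } }
  split (_◅_ {x} a w) (there v∈w) = record
    { pre = a ◅ pre
    ; post = post
    ; pre⊆ = λ { t (here t≡x) → here t≡x ; t (there t∈) → there (pre⊆ t t∈) }
    ; post⊆ = λ t t∈ → there (post⊆ t t∈)
    ; simple = λ (x∉w , w-simple) → let pre-simple , post-simple , meet = simple w-simple in
        ((λ x∈pre → x∉w (pre⊆ x x∈pre)) , pre-simple) , post-simple ,
        λ { t (here refl) t∈post → ⊥-elim (x∉w (post⊆ t t∈post)) ; t (there t∈pre) t∈post → meet t t∈pre t∈post }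
    }
    where open Split (split w v∈w)

  loopErase : ∀ {x y} (w : Walk x y) → Σ (Walk x y) λ w′ → Simple w′ × (∀ t → t ∈ₗ vertices w′ → t ∈ₗ vertices w)
  loopErase [ x ] = [ x ] , tt , λ _ t∈ → t∈
  loopErase (_◅_ {x} a w) with loopErase w
  ... | w′ , w′-simple , w′⊆w with x ∈ₗ? vertices w′
  ... | yes x∈w′ = post , proj₁ (proj₂ (simple w′-simple)) , λ t t∈ → there (w′⊆w t (post⊆ t t∈))
    where open Split (split w′ x∈w′)
  ... | no x∉w′ = a ◅ w′ , (x∉w′ , w′-simple) , λ { t (here t≡x) → here t≡x ; t (there t∈) → there (w′⊆w t t∈) }

  Inside⇒Reach : ∀ {S x y} (w : Walk x y) → Inside S w → Reach P full S x y
  Inside⇒Reach [ x ] inside = here (inside x (here refl))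
  Inside⇒Reach (a ◅ w) inside = step (inside _ (here refl)) a (Inside⇒Reach w (λ t t∈ → inside t (there t∈)))

  Reach⇒Walk : ∀ {S x y} → Reach P full S x y → Σ (Walk x y) (Inside S)
  Reach⇒Walk (here {x} x∈S) = [ x ] , λ { t (here refl) → x∈S }
  Reach⇒Walk (step x∈S a r) with Reach⇒Walk r
  ... | w , inside = a ◅ w , λ { t (here refl) → x∈S ; t (there t∈) → inside t t∈ }

  Reach⇒SimpleWalk : ∀ {S x y} → Reach P full S x y → Σ (Walk x y) λ w → Simple w × Inside S w
  Reach⇒SimpleWalk r with Reach⇒Walk r
  ... | w , inside with loopErase w
  ... | w′ , w′-simple , w′⊆w = w′ , w′-simple , λ t t∈ → inside t (w′⊆w t t∈)

  Reach-mono : ∀ {G S T x y} → S ⊆ T → Reach P G S x y → Reach P G T x y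
  Reach-mono S⊆T (here x∈S) = here (S⊆T _ x∈S)
  Reach-mono S⊆T (step x∈S a r) = step (S⊆T _ x∈S) a (Reach-mono S⊆T r)

  Reach-trans : ∀ {G S x y z} → Reach P G S x y → Reach P G S y z → Reach P G S x z
  Reach-trans (here _) r = r
  Reach-trans (step x∈S a r₁) r = step x∈S a (Reach-trans r₁ r)

  Reach-first∈ : ∀ {G S x y} → Reach P G S x y → x ∈ S
  Reach-first∈ (here x∈S) = x∈S
  Reach-first∈ (step x∈S _ _) = x∈S

  Reach-sym : ∀ {G S x y} → Reach P G S x y → Reach P G S y x
  Reach-sym (here x∈S) = here x∈S
  Reach-sym (step x∈S a r) = Reach-trans (Reach-sym r) (step (Reach-first∈ r) (HasseAdj-sym a) (here x∈S))

  CoversIn-induced : ∀ {G x y} → CoversIn P full x y → x ∈ G → y ∈ G → CoversIn P G x y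
  CoversIn-induced (_ , _ , x≤y , x≢y , between) x∈G y∈G = x∈G , y∈G , x≤y , x≢y , λ z _ → between z refl

  Reach-induced : ∀ {G S x y} → S ⊆ G → Reach P full S x y → Reach P G S x y
  Reach-induced S⊆G (here x∈S) = here x∈S
  Reach-induced S⊆G (step x∈S (inj₁ x⋖y) r) =
    step x∈S (inj₁ (CoversIn-induced x⋖y (S⊆G _ x∈S) (S⊆G _ (Reach-first∈ r)))) (Reach-induced S⊆G r)
  Reach-induced S⊆G (step x∈S (inj₂ y⋖x) r) =
    step x∈S (inj₂ (CoversIn-induced y⋖x (S⊆G _ (Reach-first∈ r)) (S⊆G _ x∈S))) (Reach-induced S⊆G r)

  CoversIn? : ∀ G x y → Dec (CoversIn P G x y)
  CoversIn? G x y = x ∈? G ×-dec (y ∈? G ×-dec ((x ⊑? y) ×-dec (¬? (x ≟ᶠ y) ×-dec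
    all? (λ z → z ∈? G →-dec ((x ⊑? z) →-dec ((z ⊑? y) →-dec ((z ≟ᶠ x) ⊎-dec (z ≟ᶠ y))))))))

  HasseAdj? : ∀ G x y → Dec (HasseAdj P G x y)
  HasseAdj? G x y = CoversIn? G x y ⊎-dec CoversIn? G y x

  -- x reaches y inside S iff x = y, or some neighbour of x reaches y inside S ─ x;
  -- the fuel is the size of S.
  Reach? : ∀ S x y → Dec (Reach P full S x y)
  Reach? S = within n S (size≤ S)
    where
    within : ∀ k S → size S ≤ k → ∀ x y → Dec (Reach P full S x y)
    within k S S≤k x y with x ∈? S
    ... | no x∉S = no λ r → x∉S (Reach-first∈ r)
    within zero S S≤0 x y | yes x∈S = ⊥-elim (n≮0 (<-≤-trans (nonempty⇒size>0 S x x∈S) S≤0))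
    within (suc k) S S≤k x y | yes x∈S with x ≟ᶠ y
    ... | yes refl = yes (here x∈S)
    ... | no x≢y with any? (λ z → HasseAdj? full x z ×-dec within k (S ─ x) S─x≤k z y)
      where
      S─x≤k : size (S ─ x) ≤ k
      S─x≤k = ≤-pred (<-≤-trans (size-strict (S ─ x) S (λ t t∈ → proj₁ (∈-─⁻ S x t∈)) x x∈S
                                    (λ x∈ → proj₂ (∈-─⁻ S x x∈) refl)) S≤k)
    ... | yes (z , x~z , r) = yes (step x∈S x~z (Reach-mono (λ t t∈ → proj₁ (∈-─⁻ S x t∈)) r))
    ... | no ¬first-step = no λ r → ¬first-step (first-step r)
      where
      first-step : Reach P full S x y → ∃ λ z → Adj x z × Reach P full (S ─ x) z y
      first-step r with Reach⇒SimpleWalk r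
      ... | [ _ ] , _ , _ = ⊥-elim (x≢y refl)
      ... | x~z ◅ w , (x∉w , _) , inside =
        _ , x~z , Inside⇒Reach w (λ t t∈ → ∈-─⁺ S x (inside t (there t∈)) λ { refl → x∉w t∈ })

  data CoverChain : Fin n → Fin n → Set where
    done : ∀ x → CoverChain x x
    _⋖∷_ : ∀ {x y z} → CoversIn P full x y → CoverChain y z → CoverChain x z

  CoverChain⇒⊑ : ∀ {x y} → CoverChain x y → x ⊑ y
  CoverChain⇒⊑ (done x) = ⊑.refl
  CoverChain⇒⊑ (x⋖y ⋖∷ c) = ⊑.trans (proj₁ (proj₂ (proj₂ x⋖y))) (CoverChain⇒⊑ c)

  interval : Fin n → Fin n → Subset n
  interval x y t = does (x ⊑? t) ∧ does (t ⊑? y)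

  ∈-interval⁺ : ∀ {x y t} → x ⊑ t → t ⊑ y → t ∈ interval x y
  ∈-interval⁺ {x} {y} {t} x⊑t t⊑y rewrite dec-true (x ⊑? t) x⊑t | dec-true (t ⊑? y) t⊑y = refl

  ∈-interval⁻ : ∀ {x y t} → t ∈ interval x y → x ⊑ t × t ⊑ y
  ∈-interval⁻ {x} {y} {t} t∈ with x ⊑? t | t ⊑? y
  ... | yes x⊑t | yes t⊑y = x⊑t , t⊑y

  -- Either x ⋖ y, or some z strictly between splits the interval into two smaller ones.
  coverChain : ∀ {x y} → x ⊑ y → CoverChain x y
  coverChain {x} {y} = refine n x y (size≤ (interval x y))
    where
    refine : ∀ k x y → size (interval x y) ≤ k → x ⊑ y → CoverChain x y
    refine k x y I≤k x⊑y with x ≟ᶠ y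
    ... | yes refl = done x
    refine zero x y I≤0 x⊑y | no _ =
      ⊥-elim (n≮0 (<-≤-trans (nonempty⇒size>0 _ x (∈-interval⁺ ⊑.refl x⊑y)) I≤0))
    refine (suc k) x y I≤k x⊑y | no x≢y
      with any? (λ z → (x ⊑? z) ×-dec ((z ⊑? y) ×-dec (¬? (z ≟ᶠ x) ×-dec ¬? (z ≟ᶠ y))))
    ... | yes (z , x⊑z , z⊑y , z≢x , z≢y) = append (refine k x z lower x⊑z) (refine k z y upper z⊑y)
      where
      append : ∀ {a b c} → CoverChain a b → CoverChain b c → CoverChain a c
      append (done _) c = c
      append (a⋖ ⋖∷ c₁) c = a⋖ ⋖∷ append c₁ c
      lower : size (interval x z) ≤ k
      lower = ≤-pred (<-≤-trans (size-strict (interval x z) (interval x y)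
        (λ t t∈ → let x⊑t , t⊑z = ∈-interval⁻ t∈ in ∈-interval⁺ x⊑t (⊑.trans t⊑z z⊑y))
        y (∈-interval⁺ x⊑y ⊑.refl) (λ y∈ → z≢y (⊑.antisym z⊑y (proj₂ (∈-interval⁻ y∈))))) I≤k)
      upper : size (interval z y) ≤ k
      upper = ≤-pred (<-≤-trans (size-strict (interval z y) (interval x y)
        (λ t t∈ → let z⊑t , t⊑y = ∈-interval⁻ t∈ in ∈-interval⁺ (⊑.trans x⊑z z⊑t) t⊑y)
        x (∈-interval⁺ ⊑.refl x⊑y) (λ x∈ → z≢x (⊑.antisym (proj₁ (∈-interval⁻ x∈)) x⊑z))) I≤k)
    ... | no ¬between = (refl , refl , x⊑y , x≢y , cover) ⋖∷ done y
      where
      cover : ∀ z → z ∈ full → x ⊑ z → z ⊑ y → (z ≡ x) ⊎ (z ≡ y)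
      cover z _ x⊑z z⊑y with z ≟ᶠ x | z ≟ᶠ y
      ... | yes z≡x | _ = inj₁ z≡x
      ... | no _ | yes z≡y = inj₂ z≡y
      ... | no z≢x | no z≢y = ⊥-elim (¬between (z , x⊑z , z⊑y , z≢x , z≢y))

  interval⇒Reach : ∀ {x y} (Y : Subset n) → x ⊑ y → (∀ t → x ⊑ t → t ⊑ y → t ∈ Y) → Reach P full Y x y
  interval⇒Reach Y x⊑y = along (coverChain x⊑y)
    where
    along : ∀ {x y} → CoverChain x y → (∀ t → x ⊑ t → t ⊑ y → t ∈ Y) → Reach P full Y x y
    along (done x) inY = here (inY x ⊑.refl ⊑.refl)
    along c@(x⋖z ⋖∷ c′) inY = step (inY _ ⊑.refl (CoverChain⇒⊑ c)) (inj₁ x⋖z)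
      (along c′ (λ t z⊑t t⊑y → inY t (⊑.trans (proj₁ (proj₂ (proj₂ x⋖z))) z⊑t) t⊑y))

  cover-closed⇒up-closed : (Q : Fin n → Set) → (∀ u v → CoversIn P full u v → Q u → Q v) →
                           ∀ {x y} → x ⊑ y → Q x → Q y
  cover-closed⇒up-closed Q closed x⊑y = along (coverChain x⊑y)
    where
    along : ∀ {x y} → CoverChain x y → Q x → Q y
    along (done _) q = q
    along (x⋖z ⋖∷ c) q = along c (closed _ _ x⋖z q)

  HasseAdj⇒≢ : ∀ {G x y} → HasseAdj P G x y → x ≢ y
  HasseAdj⇒≢ (inj₁ x⋖y) = proj₁ (proj₂ (proj₂ (proj₂ x⋖y)))
  HasseAdj⇒≢ (inj₂ y⋖x) x≡y = proj₁ (proj₂ (proj₂ (proj₂ y⋖x))) (sym x≡y)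

  Biconnected-Reach─ : ∀ {S U} → Biconnected P S → S ⊆ U → ∀ v {t c} → t ∈ S → c ∈ S → t ≢ v → c ≢ v →
                       Reach P full (U ─ v) t c
  Biconnected-Reach─ {S} {U} (_ , connected , connected─) S⊆U v t∈S c∈S t≢v c≢v with v ∈? S
  ... | yes v∈S = Reach-mono (─-mono v S⊆U) (connected─ v v∈S _ _ (∈-─⁺ S v t∈S t≢v) (∈-─⁺ S v c∈S c≢v))
  ... | no v∉S = Reach-mono (λ s s∈S → ∈-─⁺ U v (S⊆U s s∈S) λ { refl → v∉S s∈S }) (connected _ _ t∈S c∈S)

  -- Connectivity of U follows by deleting a vertex of C other than the one to be connected.
  Biconnected-extend : ∀ {C U} → Biconnected P C → C ⊆ U →
    (∀ v t → t ∈ (U ─ v) → Σ (Fin n) λ c → c ∈ C × c ≢ v × Reach P full (U ─ v) t c) →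
    Biconnected P U
  Biconnected-extend {C} {U} C-biconnected@((x , y , x∈C , y∈C , x≢y) , C-connected , _) C⊆U reach-C─ =
    (x , y , C⊆U x x∈C , C⊆U y y∈C , x≢y) ,
    (λ s t s∈ t∈ → let c , c∈ , s↝c = reach-C s∈ ; d , d∈ , t↝d = reach-C t∈ in
       Reach-trans s↝c (Reach-trans (Reach-mono C⊆U (C-connected c d c∈ d∈)) (Reach-sym t↝d))) ,
    (λ v _ s t s∈ t∈ → let c , c∈ , c≢v , s↝c = reach-C─ v s s∈ ; d , d∈ , d≢v , t↝d = reach-C─ v t t∈ in
       Reach-trans s↝c (Reach-trans (Biconnected-Reach─ C-biconnected C⊆U v c∈ d∈ c≢v d≢v) (Reach-sym t↝d)))
    where
    reach-C : ∀ {t} → t ∈ U → Σ (Fin n) λ c → c ∈ C × Reach P full U t c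
    reach-C {t} t∈ with t ≟ᶠ x
    ... | yes refl = t , x∈C , here t∈
    ... | no t≢x = let c , c∈ , _ , t↝c = reach-C─ x t (∈-─⁺ U x t∈ t≢x) in
                   c , c∈ , Reach-mono (λ s s∈ → proj₁ (∈-─⁻ U x s∈)) t↝c

  vertexSet : ∀ {x y} → Walk x y → Subset n
  vertexSet w t = does (t ∈ₗ? vertices w)

  ∈-vertexSet⁺ : ∀ {x y} {w : Walk x y} {t} → t ∈ₗ vertices w → t ∈ vertexSet w
  ∈-vertexSet⁺ {w = w} {t} t∈ = dec-true (t ∈ₗ? vertices w) t∈

  ∈-vertexSet⁻ : ∀ {x y} {w : Walk x y} {t} → t ∈ vertexSet w → t ∈ₗ vertices w
  ∈-vertexSet⁻ {w = w} {t} t∈ = from-does (t ∈ₗ? vertices w) t∈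

  -- B ∪ p is again biconnected, so by maximality of B it equals B.
  block-absorbs-simpleWalk : ∀ {B} → IsBlock P B → ∀ {b₁ b₂} (p : Walk b₁ b₂) → Simple p →
                             b₁ ∈ B → b₂ ∈ B → b₁ ≢ b₂ → Inside B p
  block-absorbs-simpleWalk {B} (B-biconnected , maximal) {b₁} {b₂} p p-simple b₁∈B b₂∈B b₁≢b₂ t t∈p =
    maximal T T-biconnected B⊆T t (p⊆T t∈p)
    where
    T : Subset n
    T = B ∪ vertexSet p

    B⊆T : B ⊆ T
    B⊆T t = ∈-∪ˡ B (vertexSet p)

    p⊆T : ∀ {t} → t ∈ₗ vertices p → t ∈ T
    p⊆T t∈p = ∈-∪ʳ B (vertexSet p) (∈-vertexSet⁺ t∈p)

    T-cases : ∀ {t} → t ∈ T → t ∈ B ⊎ t ∈ₗ vertices p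
    T-cases t∈T with ∈-∪⁻ B (vertexSet p) t∈T
    ... | inj₁ t∈B = inj₁ t∈B
    ... | inj₂ t∈p = inj₂ (∈-vertexSet⁻ t∈p)

    -- A vertex t of p reaches b₁ backwards along p or, if v lies on that stretch, b₂
    -- forwards: p is simple, so v cannot lie on both.
    reach-B─ : ∀ v t → t ∈ (T ─ v) → Σ (Fin n) λ b → b ∈ B × b ≢ v × Reach P full (T ─ v) t b
    reach-B─ v t t∈ with ∈-─⁻ T v t∈
    ... | t∈T , t≢v with T-cases t∈T
    ... | inj₁ t∈B = t , t∈B , t≢v , here t∈
    ... | inj₂ t∈p with v ∈ₗ? vertices (Split.pre (split p t∈p))
    ... | no v∉pre = b₁ , b₁∈B , (λ { refl → v∉pre (first∈ pre) }) ,
            Reach-sym (Inside⇒Reach pre (λ s s∈pre → ∈-─⁺ T v (p⊆T (pre⊆ s s∈pre)) λ { refl → v∉pre s∈pre }))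
      where open Split (split p t∈p)
    ... | yes v∈pre = b₂ , b₂∈B , (λ { refl → v∉post (last∈ post) }) ,
            Inside⇒Reach post (λ s s∈post → ∈-─⁺ T v (p⊆T (post⊆ s s∈post)) λ { refl → v∉post s∈post })
      where
      open Split (split p t∈p)
      v∉post : v ∉ₗ vertices post
      v∉post v∈post = t≢v (sym (proj₂ (proj₂ (simple p-simple)) v v∈pre v∈post))

    T-biconnected : Biconnected P T
    T-biconnected = Biconnected-extend B-biconnected B⊆T reach-B─

  Biconnected-∪ : ∀ {S₁ S₂ a d} → Biconnected P S₁ → Biconnected P S₂ →
                  a ∈ S₁ → a ∈ S₂ → d ∈ S₁ → d ∈ S₂ → a ≢ d → Biconnected P (S₁ ∪ S₂)
  Biconnected-∪ {S₁} {S₂} {a} {d} S₁-biconnected S₂-biconnected a∈₁ a∈₂ d∈₁ d∈₂ a≢d =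
    Biconnected-extend S₁-biconnected (λ t → ∈-∪ˡ S₁ S₂) reach-S₁─
    where
    shared-other-than : ∀ v → Σ (Fin n) λ c → c ∈ S₁ × c ∈ S₂ × c ≢ v
    shared-other-than v with a ≟ᶠ v
    ... | yes refl = d , d∈₁ , d∈₂ , λ d≡a → a≢d (sym d≡a)
    ... | no a≢v = a , a∈₁ , a∈₂ , a≢v

    reach-S₁─ : ∀ v t → t ∈ ((S₁ ∪ S₂) ─ v) → Σ (Fin n) λ c → c ∈ S₁ × c ≢ v × Reach P full ((S₁ ∪ S₂) ─ v) t c
    reach-S₁─ v t t∈ with ∈-─⁻ (S₁ ∪ S₂) v t∈
    ... | t∈U , t≢v with ∈-∪⁻ S₁ S₂ t∈U
    ... | inj₁ t∈₁ = t , t∈₁ , t≢v , here t∈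
    ... | inj₂ t∈₂ = let c , c∈₁ , c∈₂ , c≢v = shared-other-than v in
                     c , c∈₁ , c≢v , Biconnected-Reach─ S₂-biconnected (λ s → ∈-∪ʳ S₁ S₂) v t∈₂ c∈₂ t≢v c≢v

  blocks-sharing-two⇒⊆ : ∀ {S₁ S₂ a d} → IsBlock P S₁ → IsBlock P S₂ →
                         a ∈ S₁ → a ∈ S₂ → d ∈ S₁ → d ∈ S₂ → a ≢ d → S₁ ⊆ S₂
  blocks-sharing-two⇒⊆ {S₁} {S₂} (bic₁ , _) (bic₂ , maximal₂) a∈₁ a∈₂ d∈₁ d∈₂ a≢d t t∈₁ =
    maximal₂ _ (Biconnected-∪ bic₁ bic₂ a∈₁ a∈₂ d∈₁ d∈₂ a≢d) (λ s → ∈-∪ʳ S₁ S₂) t (∈-∪ˡ S₁ S₂ t∈₁)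

  Biconnected? : ∀ B → Dec (Biconnected P B)
  Biconnected? B =
    (any? λ x → any? λ y → x ∈? B ×-dec (y ∈? B ×-dec ¬? (x ≟ᶠ y))) ×-dec
    ((all? λ x → all? λ y → x ∈? B →-dec (y ∈? B →-dec Reach? B x y)) ×-dec
     (all? λ v → v ∈? B →-dec all? λ x → all? λ y → x ∈? (B ─ v) →-dec (y ∈? (B ─ v) →-dec Reach? (B ─ v) x y)))

  Biconnected-cong : ∀ {S T} → S ≐ T → Biconnected P S → Biconnected P T
  Biconnected-cong {S} {T} S≐T ((x , y , x∈ , y∈ , x≢y) , connected , connected─) =
    (x , y , S⊆T x x∈ , S⊆T y y∈ , x≢y) ,
    (λ a b a∈ b∈ → Reach-mono S⊆T (connected a b (T⊆S a a∈) (T⊆S b b∈))) ,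
    (λ v v∈ a b a∈ b∈ → Reach-mono (─-mono v S⊆T)
      (connected─ v (T⊆S v v∈) a b (─-mono v T⊆S a a∈) (─-mono v T⊆S b b∈)))
    where
    S⊆T = ≐⇒⊆ S≐T
    T⊆S = ≐⇒⊆ (≐-sym S≐T)

  IsBlock-cong : ∀ {S T} → S ≐ T → IsBlock P S → IsBlock P T
  IsBlock-cong S≐T (S-biconnected , maximal) = Biconnected-cong S≐T S-biconnected ,
    λ B′ B′-biconnected T⊆B′ x x∈B′ →
      ≐⇒⊆ S≐T x (maximal B′ B′-biconnected (λ y y∈S → T⊆B′ y (≐⇒⊆ S≐T y y∈S)) x x∈B′)

  ProperBiconnectedSuperset : Subset n → Subset n → Set
  ProperBiconnectedSuperset S B′ = Biconnected P B′ × S ⊆ B′ × ∃ λ t → t ∈ B′ × t ∉ S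

  block-or-extends : ∀ S → Biconnected P S → IsBlock P S ⊎ ∃ (ProperBiconnectedSuperset S)
  block-or-extends S S-biconnected with any-subset? n (ProperBiconnectedSuperset S) decide respects
    where
    decide : ∀ B′ → Dec (ProperBiconnectedSuperset S B′)
    decide B′ = Biconnected? B′ ×-dec ((all? λ t → t ∈? S →-dec t ∈? B′) ×-dec any? (λ t → t ∈? B′ ×-dec ¬? (t ∈? S)))
    respects : ∀ {B′ B″} → B′ ≐ B″ → ProperBiconnectedSuperset S B′ → ProperBiconnectedSuperset S B″
    respects B′≐B″ (bic , S⊆B′ , t , t∈B′ , t∉S) =
      Biconnected-cong B′≐B″ bic , (λ x x∈ → ≐⇒⊆ B′≐B″ x (S⊆B′ x x∈)) , t , ≐⇒⊆ B′≐B″ t t∈B′ , t∉S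
  ... | yes bigger = inj₂ bigger
  ... | no ¬bigger = inj₁ (S-biconnected , maximal)
    where
    maximal : ∀ B′ → Biconnected P B′ → S ⊆ B′ → B′ ⊆ S
    maximal B′ bic S⊆B′ t t∈B′ with t ∈? S
    ... | yes t∈S = t∈S
    ... | no t∉S = ⊥-elim (¬bigger (B′ , bic , S⊆B′ , t , t∈B′ , t∉S))

  extendToBlock : ∀ S → Biconnected P S → Σ (Subset n) λ B → IsBlock P B × S ⊆ B
  extendToBlock S = grow n S (m≤n+m n (size S))
    where
    grow : ∀ k S → n ≤ size S +ℕ k → Biconnected P S → Σ (Subset n) λ B → IsBlock P B × S ⊆ B
    grow k S n≤ bic with block-or-extends S bic
    ... | inj₁ blk = S , blk , λ _ x∈ → x∈
    ... | inj₂ (B′ , bic′ , S⊆B′ , t , t∈B′ , t∉S) with size-strict S B′ S⊆B′ t t∈B′ t∉S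
    grow zero S n≤ bic | inj₂ (B′ , _) | S<B′ =
      ⊥-elim (<-irrefl refl (<-≤-trans S<B′ (≤-trans (size≤ B′) (≤-trans n≤ (≤-reflexive (+-identityʳ _))))))
    grow (suc k) S n≤ bic | inj₂ (B′ , bic′ , S⊆B′ , _) | S<B′ =
      let B , blk , B′⊆B = grow k B′ (≤-trans n≤ (≤-trans (≤-reflexive (+-suc (size S) k)) (+-monoˡ-≤ k S<B′))) bic′
      in B , blk , λ x x∈ → B′⊆B x (S⊆B′ x x∈)

  IsBlock? : ∀ S → Dec (IsBlock P S)
  IsBlock? S with Biconnected? S
  ... | no ¬bic = no λ blk → ¬bic (proj₁ blk)
  ... | yes bic with block-or-extends S bic
  ... | inj₁ blk = yes blk
  ... | inj₂ (B′ , bic′ , S⊆B′ , t , t∈B′ , t∉S) = no λ (_ , maximal) → t∉S (maximal B′ bic′ S⊆B′ t t∈B′)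

  singleton : Fin n → Subset n
  singleton u t = does (t ≟ᶠ u)

  pair : Fin n → Fin n → Subset n
  pair u v = singleton u ∪ singleton v

  u∈pair : ∀ u v → u ∈ pair u v
  u∈pair u v = ∈-∪ˡ (singleton u) (singleton v) {u} (dec-true (u ≟ᶠ u) refl)

  v∈pair : ∀ u v → v ∈ pair u v
  v∈pair u v = ∈-∪ʳ (singleton u) (singleton v) {v} (dec-true (v ≟ᶠ v) refl)

  ∈-pair⁻ : ∀ {u v t} → t ∈ pair u v → t ≡ u ⊎ t ≡ v
  ∈-pair⁻ {u} {v} {t} t∈ with ∈-∪⁻ (singleton u) (singleton v) {t} t∈
  ... | inj₁ t≡u = inj₁ (from-does (t ≟ᶠ u) t≡u)
  ... | inj₂ t≡v = inj₂ (from-does (t ≟ᶠ v) t≡v)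

  edge-biconnected : ∀ {u v} → Adj u v → Biconnected P (pair u v)
  edge-biconnected {u} {v} u~v = (u , v , u∈pair u v , v∈pair u v , HasseAdj⇒≢ u~v) , connected , connected─
    where
    connected : ∀ x y → x ∈ pair u v → y ∈ pair u v → Reach P full (pair u v) x y
    connected x y x∈ y∈ with ∈-pair⁻ {u} {v} {x} x∈ | ∈-pair⁻ {u} {v} {y} y∈
    ... | inj₁ refl | inj₁ refl = here x∈
    ... | inj₁ refl | inj₂ refl = step x∈ u~v (here y∈)
    ... | inj₂ refl | inj₁ refl = step x∈ (HasseAdj-sym u~v) (here y∈)
    ... | inj₂ refl | inj₂ refl = here x∈
    connected─ : ∀ w → w ∈ pair u v → ∀ x y → x ∈ (pair u v ─ w) → y ∈ (pair u v ─ w) →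
                 Reach P full (pair u v ─ w) x y
    connected─ w w∈ x y x∈ y∈ with ∈-─⁻ (pair u v) w {x} x∈ | ∈-─⁻ (pair u v) w {y} y∈
    ... | x∈pair , x≢w | y∈pair , y≢w
      with ∈-pair⁻ {u} {v} {x} x∈pair | ∈-pair⁻ {u} {v} {y} y∈pair | ∈-pair⁻ {u} {v} {w} w∈
    ... | inj₁ refl | inj₁ refl | _ = here x∈
    ... | inj₂ refl | inj₂ refl | _ = here x∈
    ... | inj₁ refl | inj₂ refl | inj₁ refl = ⊥-elim (x≢w refl)
    ... | inj₁ refl | inj₂ refl | inj₂ refl = ⊥-elim (y≢w refl)
    ... | inj₂ refl | inj₁ refl | inj₁ refl = ⊥-elim (y≢w refl)
    ... | inj₂ refl | inj₁ refl | inj₂ refl = ⊥-elim (x≢w refl)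

  ConnectedIn : Subset n → Subset n → Set
  ConnectedIn G S = ∀ x y → x ∈ S → y ∈ S → Reach P G S x y

  CC-zero⇒empty : ∀ {G S} → CC P G S 0 → ∀ x → S x ≡ false
  CC-zero⇒empty (label , _) x = ≢true⇒≡false (λ x∈S → ¬Fin0 (label x x∈S))

  connected⇒¬CC-two : ∀ {G S} → ConnectedIn G S → ¬ CC P G S 2
  connected⇒¬CC-two connected (label , onto , same⇔reach)
    with onto zero | onto (suc zero)
  ... | x₀ , x₀∈ , x₀↦0 | x₁ , x₁∈ , x₁↦1 = 0≢1+n (trans (sym x₀↦0) (trans same x₁↦1))
    where
    same = Equivalence.from (same⇔reach x₀ x₁ x₀∈ x₁∈) (connected x₀ x₁ x₀∈ x₁∈)

  CC-one⇒connected : ∀ {G S} → CC P G S 1 → ConnectedIn G S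
  CC-one⇒connected (label , _ , same⇔reach) x y x∈ y∈ =
    Equivalence.to (same⇔reach x y x∈ y∈) (Fin1-unique (label x x∈) (label y y∈))
    where
    Fin1-unique : (i j : Fin 1) → i ≡ j
    Fin1-unique zero zero = refl

  CC-one⇒nonempty : ∀ {G S} → CC P G S 1 → ∃ (_∈ S)
  CC-one⇒nonempty (_ , onto , _) = let x , x∈ , _ = onto zero in x , x∈

  connected⇒CC-one : ∀ {G S} → ∃ (_∈ S) → ConnectedIn G S → CC P G S 1
  connected⇒CC-one (x , x∈) connected =
    (λ _ _ → zero) , (λ { zero → x , x∈ , refl }) ,
    λ y z y∈ z∈ → mk⇔ (λ _ → connected y z y∈ z∈) (λ _ → refl)

  -- In a connected subposet, dim(A) = 1 says exactly that A and its complement are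
  -- nonempty and connected.
  record ConnectedCut (G A : Subset n) : Set where
    field
      inner : ∃ (_∈ A)
      outer : ∃ (_∈ (G ∖ A))
      inner-connected : ConnectedIn G A
      outer-connected : ConnectedIn G (G ∖ A)

  DimOne⇒ConnectedCut : ∀ {G A} → ConnectedIn G G → A ⊆ G → DimOne P G A → ConnectedCut G A
  DimOne⇒ConnectedCut {G} {A} G-connected A⊆G (k , l , CC-A , CC-rest , dim) =
    by-sizes k l CC-A CC-rest (s-1≡1⇒s≡2 (k +ℕ l) dim)
    where
    by-sizes : ∀ k l → CC P G A k → CC P G (G ∖ A) l → k +ℕ l ≡ 2 → ConnectedCut G A
    by-sizes zero _ CC-A CC-rest refl = ⊥-elim (connected⇒¬CC-two rest-connected CC-rest)
      where
      rest-connected : ConnectedIn G (G ∖ A)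
      rest-connected x y x∈ y∈ = Reach-mono (λ t t∈G → ∈-∖⁺ G A t∈G (CC-zero⇒empty CC-A t))
        (G-connected x y (proj₁ (∈-∖⁻ G A x∈)) (proj₁ (∈-∖⁻ G A y∈)))
    by-sizes (suc zero) _ CC-A CC-rest refl = record
      { inner = CC-one⇒nonempty CC-A
      ; outer = CC-one⇒nonempty CC-rest
      ; inner-connected = CC-one⇒connected CC-A
      ; outer-connected = CC-one⇒connected CC-rest }
    by-sizes (suc (suc zero)) _ CC-A CC-rest refl = ⊥-elim (connected⇒¬CC-two A-connected CC-A)
      where
      G⊆A : G ⊆ A
      G⊆A t t∈G with A t in At
      ... | true = refl
      ... | false = ⊥-elim (false≢true (trans (sym (CC-zero⇒empty CC-rest t)) (∈-∖⁺ G A t∈G At)))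
      A-connected : ConnectedIn G A
      A-connected x y x∈ y∈ = Reach-mono G⊆A (G-connected x y (A⊆G x x∈) (A⊆G y y∈))
    by-sizes (suc (suc (suc _))) _ _ _ ()

  ConnectedCut⇒DimOne : ∀ {G A} → ConnectedCut G A → DimOne P G A
  ConnectedCut⇒DimOne cut = 1 , 1 , connected⇒CC-one inner inner-connected ,
                                    connected⇒CC-one outer outer-connected , refl
    where open ConnectedCut cut

  -- A cover u ⋖ v of the subposet G becomes a saturated chain of P inside [u, v].
  Reach-lift : ∀ {G X Y} → X ⊆ Y → (∀ u v → u ∈ X → v ∈ X → u ⊑ v → ∀ t → u ⊑ t → t ⊑ v → t ∈ Y) →
               ∀ {x y} → Reach P G X x y → Reach P full Y x y
  Reach-lift X⊆Y intervals⊆Y (here x∈X) = here (X⊆Y _ x∈X)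
  Reach-lift {Y = Y} X⊆Y intervals⊆Y (step x∈X (inj₁ x⋖z) r) =
    Reach-trans (interval⇒Reach Y x⊑z (intervals⊆Y _ _ x∈X (Reach-first∈ r) x⊑z)) (Reach-lift X⊆Y intervals⊆Y r)
    where x⊑z = proj₁ (proj₂ (proj₂ x⋖z))
  Reach-lift {Y = Y} X⊆Y intervals⊆Y (step x∈X (inj₂ z⋖x) r) =
    Reach-trans (Reach-sym (interval⇒Reach Y z⊑x (intervals⊆Y _ _ (Reach-first∈ r) x∈X z⊑x)))
                (Reach-lift X⊆Y intervals⊆Y r)
    where z⊑x = proj₁ (proj₂ (proj₂ z⋖x))

  block-connected : ∀ {B} → IsBlock P B → ConnectedIn B B
  block-connected ((_ , connected , _) , _) x y x∈ y∈ = Reach-induced (λ _ t∈ → t∈) (connected x y x∈ y∈)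

  module Projection (P-connected : HasseConnected P) {B : Subset n} (blk : IsBlock P B) where

    Outside : Fin n → Subset n
    Outside b = (full ∖ B) ∪ singleton b

    EntersAt : Fin n → Fin n → Set
    EntersAt x b = Reach P full (Outside b) x b

    ∉B⇒∈Outside : ∀ {x} b → x ∉ B → x ∈ Outside b
    ∉B⇒∈Outside {x} b x∉B = ∈-∪ˡ (full ∖ B) (singleton b) (∈-∖⁺ full B {x} refl (≢true⇒≡false x∉B))

    ∈Outside-self : ∀ b → b ∈ Outside b
    ∈Outside-self b = ∈-∪ʳ (full ∖ B) (singleton b) {b} (dec-true (b ≟ᶠ b) refl)

    ∈Outside∩B⇒≡ : ∀ {x b} → x ∈ Outside b → x ∈ B → x ≡ b
    ∈Outside∩B⇒≡ {x} {b} x∈ x∈B with ∈-∪⁻ (full ∖ B) (singleton b) {x} x∈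
    ... | inj₁ x∉B = ⊥-elim (false≢true (trans (sym (proj₂ (∈-∖⁻ full B x∉B))) x∈B))
    ... | inj₂ x≡b = from-does (x ≟ᶠ b) x≡b

    ∈Outside⇒∉B : ∀ {x b} → x ∈ Outside b → x ≢ b → x ∉ B
    ∈Outside⇒∉B x∈ x≢b x∈B = x≢b (∈Outside∩B⇒≡ x∈ x∈B)

    enters-somewhere : ∀ {x y} → Reach P full full x y → y ∈ B → ∃ λ b → b ∈ B × EntersAt x b
    enters-somewhere {x} r y∈B with x ∈? B
    ... | yes x∈B = x , x∈B , here (∈Outside-self x)
    enters-somewhere (here _) y∈B | no x∉B = ⊥-elim (x∉B y∈B)
    enters-somewhere (step _ x~z r) y∈B | no x∉B =
      let b , b∈B , z↝b = enters-somewhere r y∈B in b , b∈B , step (∉B⇒∈Outside b x∉B) x~z z↝b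

    entry-path-leaves-B : ∀ {x b} → x ∉ B → b ∈ B → EntersAt x b →
                          ∃ λ y → Adj b y × y ∉ B × Reach P full (full ∖ B) y x
    entry-path-leaves-B x∉B b∈B x↝b with Reach⇒SimpleWalk (Reach-sym x↝b)
    ... | [ _ ] , _ = ⊥-elim (x∉B b∈B)
    ... | b~y ◅ w , (b∉w , _) , inside =
      _ , b~y , outside (first∈ w) ,
      Inside⇒Reach w (λ t t∈w → ∈-∖⁺ full B refl (≢true⇒≡false (outside t∈w)))
      where
      outside : ∀ {t} → t ∈ₗ vertices w → t ∉ B
      outside {t} t∈w = ∈Outside⇒∉B (inside t (there t∈w)) λ { refl → b∉w t∈w }

    -- Two entry points would give a path b₁ ~ y ⇝ b₂ through y ∉ B, which the block
    -- would have to absorb.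
    entry-unique : ∀ {x b₁ b₂} → b₁ ∈ B → b₂ ∈ B → EntersAt x b₁ → EntersAt x b₂ → b₁ ≡ b₂
    entry-unique {x} {b₁} {b₂} b₁∈B b₂∈B x↝b₁ x↝b₂ with b₁ ≟ᶠ b₂ | x ∈? B
    ... | yes b₁≡b₂ | _ = b₁≡b₂
    ... | no _ | yes x∈B = trans (sym (∈Outside∩B⇒≡ (Reach-first∈ x↝b₁) x∈B)) (∈Outside∩B⇒≡ (Reach-first∈ x↝b₂) x∈B)
    ... | no b₁≢b₂ | no x∉B =
      let y , b₁~y , y∉B , y↝x = entry-path-leaves-B x∉B b₁∈B x↝b₁
          w , w-simple , w-inside = Reach⇒SimpleWalk (Reach-trans (Reach-mono ∖B⊆Outside y↝x) x↝b₂)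
          b₁∉w : b₁ ∉ₗ vertices w
          b₁∉w b₁∈w = b₁≢b₂ (∈Outside∩B⇒≡ (w-inside b₁ b₁∈w) b₁∈B)
      in ⊥-elim (y∉B (block-absorbs-simpleWalk blk (b₁~y ◅ w) (b₁∉w , w-simple) b₁∈B b₂∈B b₁≢b₂ _ (there (first∈ w))))
      where
      ∖B⊆Outside : (full ∖ B) ⊆ Outside b₂
      ∖B⊆Outside t t∈ = ∈-∪ˡ (full ∖ B) (singleton b₂) t∈

    π : Fin n → Fin n
    π x = proj₁ (enters-somewhere (P-connected x b₀) b₀∈B)
      where
      b₀ = proj₁ (proj₁ (proj₁ blk))
      b₀∈B = proj₁ (proj₂ (proj₂ (proj₁ (proj₁ blk))))

    π∈B : ∀ x → π x ∈ B
    π∈B x = proj₁ (proj₂ (enters-somewhere _ _))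

    enters-at-π : ∀ x → EntersAt x (π x)
    enters-at-π x = proj₂ (proj₂ (enters-somewhere _ _))

    π-unique : ∀ {x b} → b ∈ B → EntersAt x b → π x ≡ b
    π-unique b∈B x↝b = entry-unique (π∈B _) b∈B (enters-at-π _) x↝b

    π-fix : ∀ {b} → b ∈ B → π b ≡ b
    π-fix {b} b∈B = π-unique b∈B (here (∈Outside-self b))

    π-adj : ∀ {u v} → Adj u v → u ∉ B → π u ≡ π v
    π-adj {u} {v} u~v u∉B = π-unique (π∈B v) (step (∉B⇒∈Outside (π v) u∉B) u~v (enters-at-π v))

    -- Every suffix of an entry path is an entry path, so the whole path lies in the fibre.
    entry-path-in-fibre : ∀ {x b} (Y : Subset n) → b ∈ B → (∀ t → π t ≡ b → t ∈ Y) → EntersAt x b →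
                          Reach P full Y x b
    entry-path-in-fibre Y b∈B fibre⊆Y (here x∈) = here (fibre⊆Y _ (π-fix b∈B))
    entry-path-in-fibre Y b∈B fibre⊆Y x↝b@(step _ x~z z↝b) =
      step (fibre⊆Y _ (π-unique b∈B x↝b)) x~z (entry-path-in-fibre Y b∈B fibre⊆Y z↝b)

    Saturated : Subset n → Set
    Saturated Y = ∀ {x t} → x ∈ Y → π t ≡ π x → t ∈ Y

    saturated-Reach : ∀ {Y} → Saturated Y → ∀ {x y} → x ∈ Y → y ∈ Y →
                      Reach P full Y (π x) (π y) → Reach P full Y x y
    saturated-Reach {Y} saturated x∈ y∈ πx↝πy =
      Reach-trans (to-π x∈) (Reach-trans πx↝πy (Reach-sym (to-π y∈)))
      where
      to-π : ∀ {x} → x ∈ Y → Reach P full Y x (π x)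
      to-π {x} x∈ = entry-path-in-fibre Y (π∈B x) (λ t πt≡πx → saturated x∈ πt≡πx) (enters-at-π x)

    module Preimage {A : Subset n} (A-upset : IsUpset P B A) where

      ∈preimage : ∀ {b} → b ∈ A → π b ∈ A
      ∈preimage {b} b∈A = subst (_∈ A) (sym (π-fix (proj₁ A-upset b b∈A))) b∈A

      preimage-cover-closed : ∀ u v → CoversIn P full u v → π u ∈ A → π v ∈ A
      preimage-cover-closed u v u⋖v = by-cases (u ∈? B) (v ∈? B)
        where
        by-cases : Dec (u ∈ B) → Dec (v ∈ B) → π u ∈ A → π v ∈ A
        by-cases (no u∉B) _ πu∈A = subst (_∈ A) (π-adj (inj₁ u⋖v) u∉B) πu∈A
        by-cases (yes _) (no v∉B) πu∈A = subst (_∈ A) (sym (π-adj (inj₂ u⋖v) v∉B)) πu∈A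
        by-cases (yes u∈B) (yes v∈B) πu∈A = subst (_∈ A) (sym (π-fix v∈B))
          (proj₂ A-upset u v u∈B v∈B (subst (_∈ A) (π-fix u∈B) πu∈A) (proj₁ (proj₂ (proj₂ u⋖v))))

      preimage-up : ∀ {x y} → x ⊑ y → π x ∈ A → π y ∈ A
      preimage-up = cover-closed⇒up-closed (λ t → π t ∈ A) preimage-cover-closed

      preimage-down : ∀ {x y} → x ⊑ y → A (π y) ≡ false → A (π x) ≡ false
      preimage-down x⊑y πy∉A = ≢true⇒≡false (λ πx∈A → false≢true (trans (sym πy∉A) (preimage-up x⊑y πx∈A)))

      preimage-upset : IsUpset P full (A ∘ π)
      preimage-upset = (λ _ _ → refl) , λ x y _ _ πx∈A x⊑y → preimage-up x⊑y πx∈A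

      preimage-cut : ConnectedCut B A → ConnectedCut full (A ∘ π)
      preimage-cut cut = record
        { inner = let a , a∈A = inner in a , ∈preimage a∈A
        ; outer = let d , d∈ = outer in d , rest⊆ d d∈
        ; inner-connected = λ x y x∈ y∈ →
            saturated-Reach (λ x∈ πt≡πx → subst (_∈ A) (sym πt≡πx) x∈) x∈ y∈
              (Reach-lift (λ _ → ∈preimage) (λ u _ u∈A _ _ t u⊑t _ → preimage-up u⊑t (∈preimage u∈A))
                          (inner-connected (π x) (π y) x∈ y∈))
        ; outer-connected = λ x y x∈ y∈ →
            saturated-Reach (λ x∈ πt≡πx → ∈-∖⁺ full (A ∘ π) refl
                              (subst (λ s → A s ≡ false) (sym πt≡πx) (proj₂ (∈-∖⁻ full (A ∘ π) x∈)))) x∈ y∈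
              (Reach-lift rest⊆ (λ _ v _ v∈ _ t _ t⊑v → ∈-∖⁺ full (A ∘ π) refl (preimage-down t⊑v (rest-π v∈)))
                          (outer-connected (π x) (π y) (π-rest x∈) (π-rest y∈)))
        }
        where
        open ConnectedCut cut
        rest-π : ∀ {u} → u ∈ (B ∖ A) → A (π u) ≡ false
        rest-π u∈ = let u∈B , u∉A = ∈-∖⁻ B A u∈ in subst (λ t → A t ≡ false) (sym (π-fix u∈B)) u∉A
        rest⊆ : (B ∖ A) ⊆ (full ∖ (A ∘ π))
        rest⊆ u u∈ = ∈-∖⁺ full (A ∘ π) refl (rest-π u∈)
        π-rest : ∀ {x} → x ∈ (full ∖ (A ∘ π)) → π x ∈ (B ∖ A)
        π-rest {x} x∈ = ∈-∖⁺ B A (π∈B x) (proj₂ (∈-∖⁻ full (A ∘ π) x∈))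

    pushforward-Gorenstein : ∀ {r φ} → IsGorensteinLabeling P full r φ →
                             IsGorensteinLabeling P B r (pushforward π φ)
    pushforward-Gorenstein {r} {φ} (total , on-dim-one) =
      trans (sumOver-pushforward P B π φ) (trans (sumOver-cong P φ π∈B) total) ,
      λ A A-upset A-dim →
        let open Preimage A-upset
            cut = DimOne⇒ConnectedCut (block-connected blk) (proj₁ A-upset) A-dim
        in trans (sumOver-pushforward P A π φ)
                 (on-dim-one (A ∘ π) preimage-upset (ConnectedCut⇒DimOne (preimage-cut cut)))

  leaving-edge : ∀ {S A x y} → Reach P full S x y → x ∈ A → A y ≡ false →
                 ∃₂ λ u v → Adj u v × u ∈ S × v ∈ S × u ∈ A × A v ≡ false
  leaving-edge (here _) x∈A x∉A = ⊥-elim (false≢true (trans (sym x∉A) x∈A))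
  leaving-edge {A = A} (step {x} {z} x∈S x~z r) x∈A y∉A with A z in Az
  ... | true  = leaving-edge r Az y∉A
  ... | false = x , z , x~z , x∈S , Reach-first∈ r , x∈A , Az

  block-∩-connected : ∀ {B C} → IsBlock P B → ConnectedIn full C → ConnectedIn full (B ∩ C)
  block-∩-connected {B} {C} blk C-connected x y x∈ y∈ with x ≟ᶠ y
  ... | yes refl = here x∈
  ... | no x≢y =
    let x∈B , x∈C = ∈-∩⁻ B C x∈ ; y∈B , y∈C = ∈-∩⁻ B C y∈
        p , p-simple , p-inside = Reach⇒SimpleWalk (C-connected x y x∈C y∈C)
    in Inside⇒Reach p (λ t t∈p →
         ∈-∩⁺ B C (block-absorbs-simpleWalk blk p p-simple x∈B y∈B x≢y t t∈p) (p-inside t t∈p))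

  Straddles : Subset n → Subset n → Set
  Straddles A S = (∃ λ a → a ∈ S × a ∈ A) × (∃ λ d → d ∈ S × A d ≡ false)

  module _ {A : Subset n} (cut : ConnectedCut full A) where
    open ConnectedCut cut

    straddling-edge : ∀ {S} → Biconnected P S → Straddles A S →
                      ∃₂ λ u v → Adj u v × u ∈ S × v ∈ S × u ∈ A × A v ≡ false
    straddling-edge (_ , S-connected , _) ((a , a∈S , a∈A) , (d , d∈S , d∉A)) =
      leaving-edge (S-connected a d a∈S d∈S) a∈A d∉A

    -- The crossing edge of S₁ joins the crossing edge of S₂ by a simple path through A on
    -- one side and through its complement on the other, so S₂ absorbs it.
    straddling-blocks-⊆ : ∀ {S₁ S₂} → IsBlock P S₁ → IsBlock P S₂ → Straddles A S₁ → Straddles A S₂ → S₁ ⊆ S₂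
    straddling-blocks-⊆ {S₁} {S₂} blk₁ blk₂ straddles₁ straddles₂ =
      let u₁ , v₁ , u₁~v₁ , u₁∈S₁ , v₁∈S₁ , u₁∈A , v₁∉A = straddling-edge (proj₁ blk₁) straddles₁
          u₂ , v₂ , u₂~v₂ , u₂∈S₂ , v₂∈S₂ , u₂∈A , v₂∉A = straddling-edge (proj₁ blk₂) straddles₂
          p , p-simple , p-inside = Reach⇒SimpleWalk (inner-connected u₂ u₁ u₂∈A u₁∈A)
          q , q-simple , q-inside = Reach⇒SimpleWalk (outer-connected v₁ v₂ (outside v₁∉A) (outside v₂∉A))
          r = p ++⟨ u₁~v₁ ⟩ q
          r-simple = ++⟨⟩-simple p u₁~v₁ q p-simple q-simple λ t t∈p t∈q →
            false≢true (trans (sym (proj₂ (∈-∖⁻ full A (q-inside t t∈q)))) (p-inside t t∈p))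
          r⊆S₂ = block-absorbs-simpleWalk blk₂ r r-simple u₂∈S₂ v₂∈S₂ (different u₂∈A v₂∉A)
      in blocks-sharing-two⇒⊆ blk₁ blk₂ u₁∈S₁ (r⊆S₂ u₁ (∈-++⟨⟩⁺ˡ p u₁~v₁ q (last∈ p)))
                                         v₁∈S₁ (r⊆S₂ v₁ (∈-++⟨⟩⁺ʳ p u₁~v₁ q (first∈ q))) (different u₁∈A v₁∉A)
      where
      outside : ∀ {v} → A v ≡ false → v ∈ (full ∖ A)
      outside = ∈-∖⁺ full A refl
      different : ∀ {u v} → u ∈ A → A v ≡ false → u ≢ v
      different u∈A v∉A refl = false≢true (trans (sym v∉A) u∈A)

    straddling-block-cut : ∀ {S} → IsBlock P S → Straddles A S → ConnectedCut S (S ∩ A)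
    straddling-block-cut {S} blk ((a , a∈S , a∈A) , (d , d∈S , d∉A)) = record
      { inner = a , ∈-∩⁺ S A a∈S a∈A
      ; outer = d , ≐⇒⊆ (≐-sym (∖-∩ S A)) d (∈-∩⁺ S (full ∖ A) d∈S (∈-∖⁺ full A refl d∉A))
      ; inner-connected = λ x y x∈ y∈ →
          Reach-induced (λ t t∈ → proj₁ (∈-∩⁻ S A t∈)) (block-∩-connected blk inner-connected x y x∈ y∈)
      ; outer-connected = λ x y x∈ y∈ →
          Reach-induced (λ t t∈ → proj₁ (∈-∖⁻ S (S ∩ A) t∈)) (Reach-mono (≐⇒⊆ (≐-sym (∖-∩ S A)))
            (block-∩-connected blk outer-connected x y (≐⇒⊆ (∖-∩ S A) x x∈) (≐⇒⊆ (∖-∩ S A) y y∈)))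
      }

    straddling-block : HasseConnected P → Σ (Subset n) λ B → IsBlock P B × Straddles A B
    straddling-block P-connected =
      let a , a∈A = inner ; d , d∈ = outer
          u , v , u~v , _ , _ , u∈A , v∉A = leaving-edge {A = A} (P-connected a d) a∈A (proj₂ (∈-∖⁻ full A d∈))
          B , B-block , pair⊆B = extendToBlock (pair u v) (edge-biconnected u~v)
      in B , B-block , (u , pair⊆B u (u∈pair u v) , u∈A) , (v , pair⊆B v (v∈pair u v) , v∉A)

  Straddles-cong : ∀ {A S T} → S ≐ T → Straddles A S → Straddles A T
  Straddles-cong S≐T ((a , a∈S , a∈A) , (d , d∈S , d∉A)) = (a , ≐⇒⊆ S≐T a a∈S , a∈A) , (d , ≐⇒⊆ S≐T d d∈S , d∉A)

  ∩-upset : ∀ {A} S → IsUpset P full A → IsUpset P S (S ∩ A)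
  ∩-upset {A} S A-upset = (λ x x∈ → proj₁ (∈-∩⁻ S A x∈)) ,
    λ x y _ y∈S x∈ x⊑y → ∈-∩⁺ S A y∈S (proj₂ A-upset x y refl refl (proj₂ (∈-∩⁻ S A x∈)) x⊑y)

  Straddles? : ∀ A S → Dec (Straddles A S)
  Straddles? A S = any? (λ t → t ∈? S ×-dec t ∈? A) ×-dec any? (λ t → t ∈? S ×-dec A t Boolₚ.≟ false)

  ¬Straddles⇒disjoint⊎inside : ∀ A S → ¬ Straddles A S → (∀ x → (S ∩ A) x ≡ false) ⊎ (S ∩ A) ≐ S
  ¬Straddles⇒disjoint⊎inside A S ¬straddles with any? (λ t → t ∈? S ×-dec t ∈? A)
  ... | no ¬meets = inj₁ λ x → ≢true⇒≡false λ x∈ → ¬meets (x , ∈-∩⁻ S A x∈)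
  ... | yes meets = inj₂ inside
    where
    inside : (S ∩ A) ≐ S
    inside x with S x in Sx | A x in Ax
    ... | false | _ = refl
    ... | true | true = refl
    ... | true | false = ⊥-elim (¬straddles (meets , x , Sx , Ax))

  module Assembly (P-connected : HasseConnected P) {r : ℤ}
                  (labels : ∀ B → IsBlock P B → HasGorensteinLabeling P B r) where

    blockLabel : ∀ S → Dec (IsBlock P S) → Fin n → ℤ
    blockLabel S (yes blk) = extendByZero S (proj₁ (labels S blk))
    blockLabel S (no _) _ = 0ℤ

    glued : Fin n → ℤ
    glued x = sumSubsets n (λ S → blockLabel S (IsBlock? S) x)

    contribution : Subset n → ∀ S → Dec (IsBlock P S) → ℤ
    contribution X S (yes blk) = sumOver P (S ∩ X) (proj₁ (labels S blk))
    contribution X S (no _) = 0ℤ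

    sumOver-glued : ∀ X → sumOver P X glued ≡ sumSubsets n (λ S → contribution X S (IsBlock? S))
    sumOver-glued X = trans (sumOver-sumSubsets P X _) (sumSubsets-cong n (λ S → per-block S (IsBlock? S)))
      where
      per-block : ∀ S d → sumOver P X (blockLabel S d) ≡ contribution X S d
      per-block S (yes blk) = sumOver-extendByZero P X S _
      per-block S (no _) = sumOver-zero P X

    glued-total : sumOver P full glued ≡ 0ℤ
    glued-total = trans (sumOver-glued full) (sumSubsets-zero n (λ S → per-block S (IsBlock? S)))
      where
      per-block : ∀ S d → contribution full S d ≡ 0ℤ
      per-block S (yes blk) = trans (sumOver-cong P _ (λ x → Boolₚ.∧-identityʳ (S x))) (proj₁ (proj₂ (labels S blk)))
      per-block S (no _) = refl

    glued-dim-one : ∀ A → IsUpset P full A → DimOne P full A → sumOver P A glued ≡ r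
    glued-dim-one A A-upset A-dim =
      trans (sumOver-glued A) (sumSubsets-single n _ B₀ (λ S S≐B₀ → at-B₀ S S≐B₀ (IsBlock? S))
                                                         (λ S S≢B₀ → elsewhere S S≢B₀ (IsBlock? S)))
      where
      cut : ConnectedCut full A
      cut = DimOne⇒ConnectedCut (λ x y _ _ → P-connected x y) (proj₁ A-upset) A-dim

      B₀-straddling = straddling-block cut P-connected
      B₀ = proj₁ B₀-straddling
      B₀-block = proj₁ (proj₂ B₀-straddling)
      B₀-straddles = proj₂ (proj₂ B₀-straddling)

      at-B₀ : ∀ S → S ≐ B₀ → ∀ d → contribution A S d ≡ r
      at-B₀ S S≐B₀ (no ¬blk) = ⊥-elim (¬blk (IsBlock-cong (≐-sym S≐B₀) B₀-block))
      at-B₀ S S≐B₀ (yes blk) = proj₂ (proj₂ (labels S blk)) (S ∩ A) (∩-upset S A-upset)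
        (ConnectedCut⇒DimOne (straddling-block-cut cut blk (Straddles-cong (≐-sym S≐B₀) B₀-straddles)))

      elsewhere : ∀ S → ¬ S ≐ B₀ → ∀ d → contribution A S d ≡ 0ℤ
      elsewhere S S≢B₀ (no _) = refl
      elsewhere S S≢B₀ (yes blk) with Straddles? A S
      ... | yes straddles = ⊥-elim (S≢B₀ (⊆-antisym (straddling-blocks-⊆ cut blk B₀-block straddles B₀-straddles)
                                                      (straddling-blocks-⊆ cut B₀-block blk B₀-straddles straddles)))
      ... | no ¬straddles with ¬Straddles⇒disjoint⊎inside A S ¬straddles
      ...   | inj₁ disjoint = sumOver-empty P _ disjoint
      ...   | inj₂ inside = trans (sumOver-cong P _ inside) (proj₁ (proj₂ (labels S blk)))

    glued-Gorenstein : IsGorensteinLabeling P full r glued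
    glued-Gorenstein = glued-total , glued-dim-one

theorem4p3 : (n : ℕ) (P : FinPoset n) → 2 ≤ n → HasseConnected P →
    (r : ℕ) → 1 ≤ r →
    HasGorensteinLabeling P full (+ r) ⇔
      (∀ B → IsBlock P B → HasGorensteinLabeling P B (+ r))
theorem4p3 n P _ P-connected r _ = mk⇔
  (λ (φ , φ-Gorenstein) B blk → let open Projection P P-connected blk in
     pushforward π φ , pushforward-Gorenstein φ-Gorenstein)
  (λ labels → let open Assembly P P-connected labels in glued , glued-Gorenstein)
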